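{- For every $k \ge 2$, $k \oplus \mathcal{B}^{(k)} \subseteq \mathcal{B}^{(k)}$, where $k\oplus S=\{k\oplus U: U\in S\}$.
   Context: Words are over the alphabet $\mathbb{N}$; $(x.y)$ denotes the length-2 word with letters $x,y$. For $n\in\mathbb{N}$ and a word $W=w_0\cdots w_{m-1}$, $n\oplus W=(w_0+n)\cdots(w_{m-1}+n)$. For $k\ge2$ define $\mathcal{B}_1^{(k)}=\{(ki)\oplus(a.k): i\in\mathbb{N}, a\in\mathbb{N}, a\ge1\}$, $\mathcal{B}_2^{(k)}=\{(ki)\oplus(0.b): i\in\mathbb{N}, 1\le b\le k-1\}$, $\mathcal{B}_3^{(k)}=\{(a.0): a\in\mathbb{N}, a\ge1\}$, and $\mathcal{B}^{(k)}=\mathcal{B}_1^{(k)}\cup\mathcal{B}_2^{(k)}\cup\mathcal{B}_3^{(k)}$. -}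

module Defs where

open import Data.Nat using (ℕ; _+_; _*_; _≤_; _≥_)
open import Data.List using (List; []; _∷_; map)
open import Data.Product using (Σ; ∃-syntax; _×_)
open import Data.Sum using (_⊎_)
open import Relation.Binary.PropositionalEquality using (_≡_)

Word : Set
Word = List ℕ

⟨_∙_⟩ : ℕ → ℕ → Word
⟨ x ∙ y ⟩ = x ∷ y ∷ []

_⊕_ : ℕ → Word → Word
n ⊕ W = map (n +_) W

B₁ : ℕ → Word → Set
B₁ k U = ∃[ i ] ∃[ a ] (1 ≤ a × U ≡ (k * i) ⊕ ⟨ a ∙ k ⟩)

B₂ : ℕ → Word → Set
B₂ k U = ∃[ i ] ∃[ b ] (1 ≤ b × b + 1 ≤ k × U ≡ (k * i) ⊕ ⟨ 0 ∙ b ⟩)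

B₃ : ℕ → Word → Set
B₃ k U = ∃[ a ] (1 ≤ a × U ≡ ⟨ a ∙ 0 ⟩)

B : ℕ → Word → Set
B k U = B₁ k U ⊎ B₂ k U ⊎ B₃ k U

{-# OPTIONS --safe #-}
module Submission where

-- Adding k to every letter moves the block index i to i + 1, which keeps B₁ and B₂
-- in place, and turns (a.0) into (k + a . k), the block-0 word of B₁.

open import Defs
open import Data.Nat using (ℕ; _≥_; suc; _+_; _*_)
open import Data.Nat.Properties using (*-suc; *-zeroʳ; +-assoc; +-identityʳ; m≤n⇒m≤o+n)
open import Data.List using (map)
open import Data.List.Properties using (map-∘; map-cong)
open import Data.Product using (_,_)
open import Data.Sum using (inj₁; inj₂)
open import Relation.Binary.PropositionalEquality using (_≡_; refl; cong; module ≡-Reasoning)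

⊕-⊕ : ∀ m n W → m ⊕ (n ⊕ W) ≡ (m + n) ⊕ W
⊕-⊕ m n W = begin
  m ⊕ (n ⊕ W)                ≡⟨ map-∘ W ⟨
  map (λ x → m + (n + x)) W  ≡⟨ map-cong (+-assoc m n) W ⟨
  (m + n) ⊕ W                ∎
  where open ≡-Reasoning

⊕-shift-block : ∀ k i W → k ⊕ ((k * i) ⊕ W) ≡ (k * suc i) ⊕ W
⊕-shift-block k i W = begin
  k ⊕ ((k * i) ⊕ W)  ≡⟨ ⊕-⊕ k (k * i) W ⟩
  (k + k * i) ⊕ W    ≡⟨ cong (_⊕ W) (*-suc k i) ⟨
  (k * suc i) ⊕ W    ∎
  where open ≡-Reasoning

B₁-⊕-closed : ∀ {k U} → B₁ k U → B₁ k (k ⊕ U)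
B₁-⊕-closed {k} (i , a , 1≤a , refl) = suc i , a , 1≤a , ⊕-shift-block k i ⟨ a ∙ k ⟩

B₂-⊕-closed : ∀ {k U} → B₂ k U → B₂ k (k ⊕ U)
B₂-⊕-closed {k} (i , b , 1≤b , b<k , refl) = suc i , b , 1≤b , b<k , ⊕-shift-block k i ⟨ 0 ∙ b ⟩

B₃-⊕⇒B₁ : ∀ {k U} → B₃ k U → B₁ k (k ⊕ U)
B₃-⊕⇒B₁ {k} (a , 1≤a , refl) = 0 , k + a , m≤n⇒m≤o+n k 1≤a , k⊕⟨a∙0⟩≡block₀
  where
  k⊕⟨a∙0⟩≡block₀ : k ⊕ ⟨ a ∙ 0 ⟩ ≡ (k * 0) ⊕ ⟨ k + a ∙ k ⟩
  k⊕⟨a∙0⟩≡block₀ rewrite *-zeroʳ k | +-identityʳ k = refl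

lemma5p1 : (k : ℕ) → k ≥ 2 → (U : Word) → B k U → B k (k ⊕ U)
lemma5p1 k _ U (inj₁ U∈B₁)        = inj₁ (B₁-⊕-closed U∈B₁)
lemma5p1 k _ U (inj₂ (inj₁ U∈B₂)) = inj₂ (inj₁ (B₂-⊕-closed U∈B₂))
lemma5p1 k _ U (inj₂ (inj₂ U∈B₃)) = inj₁ (B₃-⊕⇒B₁ U∈B₃)
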